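{- Let $G$ be a group generated as a monoid by a subset $A\subseteq G$ that is closed under $G$-conjugation, and let $c\in G$ with $n=\ell_A(c)$. Suppose that $\mathrm{Red}_A(c)$ is finite, that $\mathcal{P}_c(G,A)$ is chain-connected, and that it admits a $c$-compatible order of $A_c$. Then the Hurwitz action of $B_n$ on $\mathrm{Red}_A(c)$ is transitive.
   Context: For $x\in G$, $\ell_A(x)$ is the least $k\ge 0$ such that $x=a_1\cdots a_k$ with all $a_i\in A$. Such a factorization with $k=\ell_A(x)$ is a reduced $A$-factorization; $\mathrm{Red}_A(x)$ is the set of these, written as tuples. The $A$-prefix order is $x\le_A y$ iff $\ell_A(x)+\ell_A(x^{ -1}y)=\ell_A(y)$. The factorization poset $\mathcal{P}_c(G,A)$ is $[e,c]_A=\{x: e\le_A x\le_A c\}$ with the order $\le_A$. $A_c=\{a\in A: a\le_A c\}$. A linear order $\prec$ on $A_c$ is $c$-compatible if every $g\le_A c$ with $\ell_A(g)=2$ has exactly one reduced $A$-factorization $(a,b)$ with $a\preceq b$. The chain graph of a finite bounded graded poset has the maximal chains as vertices, two being adjacent when they differ in exactly one element; the poset is chain-connected if this graph is connected. The Hurwitz action of the braid group $B_n=\langle\sigma_1,\dots,\sigma_{n-1}\rangle$ on $\mathrm{Red}_A(c)$ is given by $\sigma_i\cdot(a_1,\dots,a_n)=(a_1,\dots,a_{i-1},a_{i+1},a_{i+1}^{ -1}a_ia_{i+1},a_{i+2},\dots,a_n)$. -}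

module Defs where

open import Level using (0ℓ)
open import Data.Nat using (ℕ; _+_; _≤_)
open import Data.List using (List; []; _∷_; length; foldr; _∷ʳ_)
open import Data.List.Relation.Unary.All using (All)
open import Data.List.Relation.Unary.Linked using (Linked)
open import Data.List.Membership.Propositional using (_∈_)
open import Data.Product using (Σ; ∃; _×_; _,_)
open import Data.Sum using (_⊎_)
open import Data.Empty using (⊥)
open import Relation.Nullary using (¬_)
open import Relation.Binary.PropositionalEquality using (_≡_; _≢_)
open import Relation.Binary.Construct.Closure.ReflexiveTransitive using (Star)
open import Algebra.Core using (Op₁; Op₂)
open import Algebra.Structures using (IsGroup)

record GroupOn (G : Set) : Set where
  field
    _∙_     : Op₂ G
    ε       : G
    _⁻¹     : Op₁ G
    isGroup : IsGroup _≡_ _∙_ ε _⁻¹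
  infixl 7 _∙_
  infix 8 _⁻¹

module _ {G : Set} (Grp : GroupOn G) (A : G → Set) where
  open GroupOn Grp

  prod : List G → G
  prod = foldr _∙_ ε

  ConjClosed : Set
  ConjClosed = ∀ (g a : G) → A a → A ((g ⁻¹ ∙ a) ∙ g)

  MonoidGenerates : Set
  MonoidGenerates = ∀ (x : G) → ∃ λ (as : List G) → All A as × prod as ≡ x

  Fact : G → ℕ → Set
  Fact x k = ∃ λ (as : List G) → length as ≡ k × All A as × prod as ≡ x

  HasLength : G → ℕ → Set
  HasLength x k = Fact x k × (∀ m → Fact x m → k ≤ m)

  IsRed : G → List G → Set
  IsRed x as = All A as × prod as ≡ x × (∀ m → Fact x m → length as ≤ m)

  RedFinite : G → Set
  RedFinite c = ∃ λ (L : List (List G)) → ∀ as → IsRed c as → as ∈ L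

  _≤A_ : G → G → Set
  x ≤A y = ∃ λ i → ∃ λ j → ∃ λ k →
    HasLength x i × HasLength (x ⁻¹ ∙ y) j × HasLength y k × i + j ≡ k

  _<A_ : G → G → Set
  x <A y = x ≤A y × x ≢ y

  InP : G → G → Set
  InP c x = ε ≤A x × x ≤A c

  Covers : G → G → G → Set
  Covers c x y = x <A y × (∀ z → InP c z → x <A z → z <A y → ⊥)

  -- maximal chains of the finite bounded poset P_c(G,A), listed bottom to top:
  -- e = x₀ ⋖ x₁ ⋖ ⋯ ⋖ x_m = c
  MaxChain : G → List G → Set
  MaxChain c xs = (∃ λ ys → xs ≡ ε ∷ ys) × (∃ λ ys → xs ≡ ys ∷ʳ c)
                × All (InP c) xs × Linked (Covers c) xs

  -- two chains (as sorted lists) differing in exactly one element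
  data OneDiff : List G → List G → Set where
    here  : ∀ {x y xs} → x ≢ y → OneDiff (x ∷ xs) (y ∷ xs)
    there : ∀ {x xs ys} → OneDiff xs ys → OneDiff (x ∷ xs) (x ∷ ys)

  ChainConnected : G → Set
  ChainConnected c = ∀ xs ys → MaxChain c xs → MaxChain c ys →
    Star (λ u v → MaxChain c u × MaxChain c v × OneDiff u v) xs ys

  Ac : G → G → Set
  Ac c a = A a × a ≤A c

  IsLinearOrderOn : G → (G → G → Set) → Set
  IsLinearOrderOn c _⪯_ =
      (∀ a → Ac c a → a ⪯ a)
    × (∀ a b → Ac c a → Ac c b → a ⪯ b → b ⪯ a → a ≡ b)
    × (∀ a b d → Ac c a → Ac c b → Ac c d → a ⪯ b → b ⪯ d → a ⪯ d)
    × (∀ a b → Ac c a → Ac c b → a ⪯ b ⊎ b ⪯ a)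

  IsCompatible : G → (G → G → Set) → Set
  IsCompatible c _⪯_ = ∀ g → g ≤A c → HasLength g 2 →
    ∃ λ a → ∃ λ b → (Ac c a × Ac c b × a ∙ b ≡ g × a ⪯ b)
      × (∀ a' b' → Ac c a' → Ac c b' → a' ∙ b' ≡ g → a' ⪯ b' → a' ≡ a × b' ≡ b)

  AdmitsCompatibleOrder : G → Set₁
  AdmitsCompatibleOrder c = ∃ λ (_⪯_ : G → G → Set) → IsLinearOrderOn c _⪯_ × IsCompatible c _⪯_

  -- action of a generator σᵢ of B_n on n-tuples
  data HurwitzStep : List G → List G → Set where
    swap : ∀ {a b xs} → HurwitzStep (a ∷ b ∷ xs) (b ∷ ((b ⁻¹ ∙ a) ∙ b) ∷ xs)
    skip : ∀ {x xs ys} → HurwitzStep xs ys → HurwitzStep (x ∷ xs) (x ∷ ys)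

  -- s lies in the B_n-orbit of r (words in σᵢ^{±1})
  HurwitzRelated : List G → List G → Set
  HurwitzRelated = Star (λ u v → HurwitzStep u v ⊎ HurwitzStep v u)

module Submission where

-- A reduced factorisation r = (a₁,…,aₙ) of c determines its chain of prefixes
-- e ⋖ a₁ ⋖ a₁a₂ ⋖ ⋯ ⋖ c in P_c(G,A), and every maximal chain arises in this way
-- (prefix-chain-maximal, maximal-chain-is-prefix-chain).  Two maximal chains that
-- differ in one element come from factorisations that agree except in two adjacent
-- positions, whose products g agree (differ-by-one).  Such a g lies below c and has
-- length 2, so c-compatibility singles out one factorisation (α,β) of g with α ⪯ β.
-- Iterating the Hurwitz move on the two positions stays inside the finite set
-- Red_A(c), so the first letters repeat; they cannot strictly ⪯-decrease around a
-- cycle, hence some iterate (p,q) has p ⪯ q and therefore equals (α,β) (local-move).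
-- Chain-connectivity then glues local moves into a Hurwitz path between any two
-- reduced factorisations.

open import Defs
open import Level using (0ℓ)
open import Algebra.Bundles using (Group)
import Algebra.Properties.Group as GroupProperties
open import Data.Nat using (ℕ; zero; suc; _+_; _∸_; _≤_; _<_; z≤n; s≤s; s≤s⁻¹)
open import Data.Nat.Properties
open import Algebra.Properties.CommutativeSemigroup +-commutativeSemigroup using (x∙yz≈y∙xz)
open import Data.Fin using (toℕ)
open import Data.Fin.Properties using (pigeonhole)
open import Data.List using (List; []; _∷_; length; _++_; _∷ʳ_; map; lookup)
open import Data.List.Properties using (length-++; length-map; ++-assoc; ∷-injective; ∷-injectiveˡ; ++-cancelˡ)
open import Data.List.Relation.Unary.All as All using (All; []; _∷_)
import Data.List.Relation.Unary.All.Properties as AllP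
open import Data.List.Relation.Unary.Any using (index)
open import Data.List.Relation.Unary.Any.Properties using (lookup-index)
open import Data.List.Relation.Unary.Linked using (Linked; [-]; _∷_)
open import Data.List.Membership.Propositional using (_∈_)
open import Data.Product using (∃; _×_; _,_; proj₁; proj₂)
open import Data.Sum using (_⊎_; inj₁; inj₂)
import Data.Sum as Sum
open import Data.Empty using (⊥; ⊥-elim)
open import Relation.Binary.PropositionalEquality
open import Relation.Binary.Construct.Closure.ReflexiveTransitive using (Star; ε; _◅_; _◅◅_; gmap; reverse)

-- A sequence all of whose values lie in a fixed finite list takes some value twice
-- (pigeonhole); this is where finiteness of Red_A(c) enters.
sequence-repeats : ∀ {X : Set} (L : List X) (f : ℕ → X) → (∀ k → f k ∈ L) →
                   ∃ λ i → ∃ λ j → i < j × f i ≡ f j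
sequence-repeats L f mem with pigeonhole (n<1+n (length L)) (λ i → index (mem (toℕ i)))
... | i , j , i<j , same-index =
  toℕ i , toℕ j , i<j ,
  trans (lookup-index (mem (toℕ i)))
        (trans (cong (lookup L) same-index) (sym (lookup-index (mem (toℕ j)))))

oneDiff-cons : ∀ {G : Set} {Grp : GroupOn G} {A : G → Set} {x y : G} {xs ys : List G} →
               OneDiff Grp A (x ∷ xs) (y ∷ ys) → (x ≢ y × xs ≡ ys) ⊎ (x ≡ y × OneDiff Grp A xs ys)
oneDiff-cons (here x≢y) = inj₁ (x≢y , refl)
oneDiff-cons (there d)  = inj₂ (refl , d)

module HurwitzTheory {G : Set} (Grp : GroupOn G) (A : G → Set) where
  open GroupOn Grp renaming (ε to e)
  open ≡-Reasoning

  -- The group as a standard-library bundle, to reuse its derived laws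
  -- (cancellation, x (x⁻¹ y) = y and x⁻¹ (x y) = y).
  group : Group 0ℓ 0ℓ
  group = record { isGroup = isGroup }

  open Group group using (assoc; identityˡ; identityʳ; inverseˡ)
  open GroupProperties group using (∙-cancelˡ; \\-leftDividesˡ; \\-leftDividesʳ)

  conj : G → G → G
  conj g a = (g ⁻¹ ∙ a) ∙ g

  conj-slide : ∀ g a x → g ∙ (conj g a ∙ x) ≡ a ∙ (g ∙ x)
  conj-slide g a x = begin
    g ∙ (((g ⁻¹ ∙ a) ∙ g) ∙ x) ≡⟨ cong (g ∙_) (assoc _ _ _) ⟩
    g ∙ ((g ⁻¹ ∙ a) ∙ (g ∙ x)) ≡⟨ sym (assoc _ _ _) ⟩
    (g ∙ (g ⁻¹ ∙ a)) ∙ (g ∙ x) ≡⟨ cong (_∙ (g ∙ x)) (\\-leftDividesˡ g a) ⟩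
    a ∙ (g ∙ x)                ∎

  left-quotient-trivial : ∀ x y → x ⁻¹ ∙ y ≡ e → x ≡ y
  left-quotient-trivial x y eq = begin
    x                ≡⟨ sym (identityʳ x) ⟩
    x ∙ e            ≡⟨ cong (x ∙_) (sym eq) ⟩
    x ∙ (x ⁻¹ ∙ y)   ≡⟨ \\-leftDividesˡ x y ⟩
    y                ∎

  Fct : G → ℕ → Set
  Fct = Fact Grp A

  Len : G → ℕ → Set
  Len = HasLength Grp A

  Red : G → List G → Set
  Red = IsRed Grp A

  infix 4 _≤ₐ_ _<ₐ_

  _≤ₐ_ : G → G → Set
  _≤ₐ_ = Defs._≤A_ Grp A

  _<ₐ_ : G → G → Set
  _<ₐ_ = Defs._<A_ Grp A

  pr : List G → G
  pr = prod Grp A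

  prod-++ : ∀ u v → pr (u ++ v) ≡ pr u ∙ pr v
  prod-++ []      v = sym (identityˡ _)
  prod-++ (x ∷ u) v = trans (cong (x ∙_) (prod-++ u v)) (sym (assoc _ _ _))

  prod-snoc : ∀ u a → pr u ∙ a ≡ pr (u ∷ʳ a)
  prod-snoc u a = sym (trans (prod-++ u (a ∷ [])) (cong (pr u ∙_) (identityʳ a)))

  prod-conj : ∀ g u → pr (map (conj g) u) ≡ conj g (pr u)
  prod-conj g []      = sym (trans (cong (_∙ g) (identityʳ _)) (inverseˡ g))
  prod-conj g (a ∷ u) = begin
    conj g a ∙ pr (map (conj g) u)      ≡⟨ cong (conj g a ∙_) (prod-conj g u) ⟩
    conj g a ∙ ((g ⁻¹ ∙ pr u) ∙ g)      ≡⟨ sym (assoc _ _ _) ⟩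
    (conj g a ∙ (g ⁻¹ ∙ pr u)) ∙ g      ≡⟨ cong (_∙ g) (assoc _ _ _) ⟩
    ((g ⁻¹ ∙ a) ∙ (g ∙ (g ⁻¹ ∙ pr u))) ∙ g ≡⟨ cong (λ t → ((g ⁻¹ ∙ a) ∙ t) ∙ g) (\\-leftDividesˡ g (pr u)) ⟩
    ((g ⁻¹ ∙ a) ∙ pr u) ∙ g             ≡⟨ cong (_∙ g) (assoc _ _ _) ⟩
    conj g (a ∙ pr u)                   ∎

  fact-∙ : ∀ {x w i j} → Fct x i → Fct w j → Fct (x ∙ w) (i + j)
  fact-∙ (u , refl , Au , refl) (v , refl , Av , refl) =
    u ++ v , length-++ u , AllP.++⁺ Au Av , prod-++ u v

  fact-letter : ∀ {a} → A a → Fct a 1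
  fact-letter {a} Aa = a ∷ [] , refl , Aa ∷ [] , identityʳ a

  fact-e : Fct e 0
  fact-e = [] , refl , [] , refl

  length-e : Len e 0
  length-e = fact-e , λ _ _ → z≤n

  length-unique : ∀ {x i j} → Len x i → Len x j → i ≡ j
  length-unique (fi , min-i) (fj , min-j) = ≤-antisym (min-i _ fj) (min-j _ fi)

  length-zero : ∀ {x} → Len x 0 → x ≡ e
  length-zero (([] , _ , _ , prod≡x) , _) = sym prod≡x

  different-lengths : ∀ {x y i k} → Len x i → Len y k → i ≢ k → x ≢ y
  different-lengths hx hy i≢k refl = i≢k (length-unique hx hy)

  split-length : ∀ {y x w k i j} → Len y k → y ≡ x ∙ w → Fct x i → Fct w j → i + j ≡ k →
                 Len x i × Len w j × x ≤ₐ y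
  split-length {y} {x} {w} {k} {i} {j} (fy , min-y) y≡xw fx fw i+j≡k =
    len-x , len-w , (i , j , k , len-x , subst (λ t → Len t j) (sym quotient) len-w , (fy , min-y) , i+j≡k)
    where
    factor-y : ∀ {m} → Fct (x ∙ w) m → k ≤ m
    factor-y f = min-y _ (subst (λ t → Fct t _) (sym y≡xw) f)
    len-x : Len x i
    len-x = fx , λ m fm → +-cancelʳ-≤ j i m (subst (_≤ m + j) (sym i+j≡k) (factor-y (fact-∙ fm fw)))
    len-w : Len w j
    len-w = fw , λ m fm → +-cancelˡ-≤ i j m (subst (_≤ i + m) (sym i+j≡k) (factor-y (fact-∙ fx fm)))
    quotient : x ⁻¹ ∙ y ≡ w
    quotient = trans (cong (x ⁻¹ ∙_) y≡xw) (\\-leftDividesʳ x w)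

  e-below : ∀ {x i} → Len x i → e ≤ₐ x
  e-below {x} hx = proj₂ (proj₂ (split-length hx (sym (identityˡ x)) fact-e (proj₁ hx) refl))

  e-below-upper : ∀ {x y} → x ≤ₐ y → e ≤ₐ y
  e-below-upper (_ , _ , _ , _ , _ , hy , _) = e-below hy

  -- The prefix order is transitive: x⁻¹z = (x⁻¹y)(y⁻¹z) and the lengths add up.
  ≤ₐ-trans : ∀ {x y z} → x ≤ₐ y → y ≤ₐ z → x ≤ₐ z
  ≤ₐ-trans {x} {y} {z} (i , j , k , hx , hxy , hy , i+j≡k) (k' , j' , m , hy' , hyz , hz , k'+j'≡m) =
    proj₂ (proj₂ (split-length hz z≡x[x⁻¹z] (proj₁ hx) (fact-∙ (proj₁ hxy) (proj₁ hyz)) lengths))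
    where
    z≡x[x⁻¹z] : z ≡ x ∙ ((x ⁻¹ ∙ y) ∙ (y ⁻¹ ∙ z))
    z≡x[x⁻¹z] = begin
      z                              ≡⟨ sym (\\-leftDividesˡ y z) ⟩
      y ∙ (y ⁻¹ ∙ z)                 ≡⟨ cong (_∙ (y ⁻¹ ∙ z)) (sym (\\-leftDividesˡ x y)) ⟩
      (x ∙ (x ⁻¹ ∙ y)) ∙ (y ⁻¹ ∙ z)  ≡⟨ assoc _ _ _ ⟩
      x ∙ ((x ⁻¹ ∙ y) ∙ (y ⁻¹ ∙ z))  ∎
    lengths : i + (j + j') ≡ m
    lengths = begin
      i + (j + j') ≡⟨ sym (+-assoc i j j') ⟩
      (i + j) + j' ≡⟨ cong (_+ j') (trans i+j≡k (length-unique hy hy')) ⟩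
      k' + j'      ≡⟨ k'+j'≡m ⟩
      m            ∎

  <ₐ-length : ∀ {x z i k} → x <ₐ z → Len x i → Len z k → i < k
  <ₐ-length ((_ , zero , _ , _ , hq , _ , _) , x≢z) _ _ =
    ⊥-elim (x≢z (left-quotient-trivial _ _ (length-zero hq)))
  <ₐ-length ((i' , suc j , k' , hx' , _ , hz' , i'+j≡k') , _) hx hz =
    subst₂ _<_ (length-unique hx' hx) (trans i'+j≡k' (length-unique hz' hz)) (m<m+n i' (s≤s z≤n))

  no-element-between : ∀ {x y z i} → Len x i → Len y (suc i) → x <ₐ z → z <ₐ y → ⊥
  no-element-between hx hy x<z@((_ , _ , _ , _ , _ , hz , _) , _) z<y =
    <⇒≱ (<ₐ-length x<z hx hz) (s≤s⁻¹ (<ₐ-length z<y hz hy))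

  reduced-split : ∀ {c} u v → Red c (u ++ v) →
                  Len (pr u) (length u) × Len (pr v) (length v) × pr u ≤ₐ c
  reduced-split u v (Auv , prod≡c , minimal) =
    split-length ((u ++ v , refl , Auv , prod≡c) , minimal) (trans (sym prod≡c) (prod-++ u v))
      (u , refl , AllP.++⁻ˡ u Auv , refl) (v , refl , AllP.++⁻ʳ u Auv , refl) (sym (length-++ u))

  reduced-snoc : ∀ {c} u a r → Red c (u ++ a ∷ r) → Red c ((u ∷ʳ a) ++ r)
  reduced-snoc {c} u a r = subst (Red c) (sym (++-assoc u (a ∷ []) r))

  letter-of-reduced : ∀ {c} u a r → Red c (u ++ a ∷ r) → A a
  letter-of-reduced u a r (Aw , _) with AllP.++⁻ʳ u Aw
  ... | Aa ∷ _ = Aa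

  letter-between : ∀ {x y i k b} w → Len x i → Len y k → A b → All A w →
                   y ≡ (x ∙ b) ∙ pr w → i + suc (length w) ≡ k → 0 < length w →
                   x <ₐ x ∙ b × x ∙ b <ₐ y
  letter-between {x} {y} {i} {k} {b} w hx hy Ab Aw y≡xbw lengths w-nonempty
    with split-length hy y≡xbw (fact-∙ (proj₁ hx) (fact-letter Ab)) (w , refl , Aw , refl)
                      (trans (+-assoc i 1 (length w)) lengths)
  ... | hz , _ , z≤y =
    (x≤z , different-lengths hx hz (<⇒≢ (m<m+n i (s≤s z≤n)))) ,
    (z≤y , different-lengths hz hy (<⇒≢ (subst (i + 1 <_) lengths (+-monoʳ-< i (s≤s w-nonempty)))))
    where
    x≤z : x ≤ₐ x ∙ b
    x≤z = proj₂ (proj₂ (split-length hz refl (proj₁ hx) (fact-letter Ab) refl))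

  -- Prefix chains

  mutual
    prefixChain : G → List G → List G
    prefixChain x r = x ∷ prefixTail x r

    prefixTail : G → List G → List G
    prefixTail x []      = []
    prefixTail x (a ∷ r) = prefixChain (x ∙ a) r

  prefixChain-injective : ∀ x x' r r' → prefixChain x r ≡ prefixChain x' r' → x ≡ x' × r ≡ r'
  prefixChain-injective x x' []      []       eq = ∷-injectiveˡ eq , refl
  prefixChain-injective x x' (a ∷ r) (a' ∷ r') eq with ∷-injective eq
  ... | refl , tails with prefixChain-injective (x ∙ a) (x ∙ a') r r' tails
  ... | xa≡xa' , refl = refl , cong (_∷ r) (∙-cancelˡ x a a' xa≡xa')

  prefixChain-last : ∀ x r y → x ∙ pr r ≡ y → ∃ λ ys → prefixChain x r ≡ ys ∷ʳ y
  prefixChain-last x []      y eq = [] , cong (_∷ []) (trans (sym (identityʳ x)) eq)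
  prefixChain-last x (a ∷ r) y eq with prefixChain-last (x ∙ a) r y (trans (assoc x a (pr r)) eq)
  ... | ys , last = x ∷ ys , cong (x ∷_) last

  snoc-singleton : ∀ {x y : G} zs → x ∷ [] ≡ zs ∷ʳ y → x ≡ y
  snoc-singleton []          eq = ∷-injectiveˡ eq
  snoc-singleton (_ ∷ [])    ()
  snoc-singleton (_ ∷ _ ∷ _) ()

  snoc-tail : ∀ {x x' y : G} {xs} zs → x ∷ x' ∷ xs ≡ zs ∷ʳ y → ∃ λ zs' → x' ∷ xs ≡ zs' ∷ʳ y
  snoc-tail (_ ∷ zs) eq = zs , proj₂ (∷-injective eq)

  -- Covers in P_c(G,A) and the chains coming from reduced factorisations

  module _ (c : G) where

    InPc : G → Set
    InPc = InP Grp A c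

    Cov : G → G → Set
    Cov = Covers Grp A c

    prefix-in-P : ∀ u r → Red c (u ++ r) → InPc (pr u)
    prefix-in-P u r rd with reduced-split u r rd
    ... | len-u , _ , u≤c = e-below len-u , u≤c

    prefix-cover : ∀ u a r → Red c (u ++ a ∷ r) → Cov (pr u) (pr u ∙ a)
    prefix-cover u a r rd =
      (proj₂ (proj₂ (split-length len-ua refl (proj₁ len-u) (fact-letter Aa) (+-comm (length u) 1))) ,
       different-lengths len-u len-ua (≢-sym 1+n≢n)) ,
      λ _ _ → no-element-between len-u len-ua
      where
      Aa : A a
      Aa = letter-of-reduced u a r rd
      len-u : Len (pr u) (length u)
      len-u = proj₁ (reduced-split u (a ∷ r) rd)
      len-ua : Len (pr u ∙ a) (suc (length u))
      len-ua = subst₂ Len (sym (prod-snoc u a)) (trans (length-++ u) (+-comm (length u) 1))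
                      (proj₁ (reduced-split (u ∷ʳ a) r (reduced-snoc u a r rd)))

    cover-is-letter : ∀ {x y} → InPc y → Cov x y →
                      ∃ λ a → A a × x ∙ a ≡ y × (∀ i → Len x i → Len y (suc i))
    cover-is-letter {x} {y} (_ , y≤c) (((i , j , k , hx , hq , hy , i+j≡k) , x≢y) , nothing-between)
      with proj₁ hq
    ... | [] , _ , _ , e≡q = ⊥-elim (x≢y (left-quotient-trivial x y (sym e≡q)))
    ... | b ∷ [] , refl , Ab ∷ [] , b≡q = b , Ab , x∙b≡y , λ i' hx' → subst (Len y) (k≡1+ i' hx') hy
      where
      x∙b≡y : x ∙ b ≡ y
      x∙b≡y = begin
        x ∙ b            ≡⟨ cong (x ∙_) (sym (identityʳ b)) ⟩
        x ∙ (b ∙ e)      ≡⟨ cong (x ∙_) b≡q ⟩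
        x ∙ (x ⁻¹ ∙ y)   ≡⟨ \\-leftDividesˡ x y ⟩
        y                ∎
      k≡1+ : ∀ i' → Len x i' → k ≡ suc i'
      k≡1+ i' hx' = trans (sym i+j≡k) (trans (+-comm i 1) (cong suc (length-unique hx hx')))
    ... | b ∷ w@(_ ∷ _) , refl , Ab ∷ Aw , bw≡q
      with letter-between w hx hy Ab Aw y≡xbw i+j≡k (s≤s z≤n)
      where
      y≡xbw : y ≡ (x ∙ b) ∙ pr w
      y≡xbw = begin
        y                ≡⟨ sym (\\-leftDividesˡ x y) ⟩
        x ∙ (x ⁻¹ ∙ y)   ≡⟨ cong (x ∙_) (sym bw≡q) ⟩
        x ∙ (b ∙ pr w)   ≡⟨ sym (assoc x b (pr w)) ⟩
        (x ∙ b) ∙ pr w   ∎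
    ...   | x<z , z<y@(z≤y , _) =
      ⊥-elim (nothing-between (x ∙ b) (e-below-upper (proj₁ x<z) , ≤ₐ-trans z≤y y≤c) x<z z<y)

    prefix-chain-valid : ∀ u r → Red c (u ++ r) →
                         All InPc (prefixChain (pr u) r) × Linked Cov (prefixChain (pr u) r)
    prefix-chain-valid u []      rd = prefix-in-P u [] rd ∷ [] , [-]
    prefix-chain-valid u (a ∷ r) rd with subst (λ t → All InPc (prefixChain t r) × Linked Cov (prefixChain t r))
                                              (sym (prod-snoc u a))
                                              (prefix-chain-valid (u ∷ʳ a) r (reduced-snoc u a r rd))
    ... | inP , linked = prefix-in-P u (a ∷ r) rd ∷ inP , prefix-cover u a r rd ∷ linked

    prefix-chain-maximal : ∀ {r} → Red c r → MaxChain Grp A c (prefixChain e r)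
    prefix-chain-maximal {r} rd =
      (prefixTail e r , refl) , prefixChain-last e r c (trans (identityˡ _) (proj₁ (proj₂ rd))) ,
      prefix-chain-valid [] r rd

    chain-word : ∀ x rest → All InPc (x ∷ rest) → Linked Cov (x ∷ rest) → (∃ λ zs → x ∷ rest ≡ zs ∷ʳ c) →
                 ∃ λ r → prefixChain x r ≡ x ∷ rest × All A r × x ∙ pr r ≡ c ×
                         (∀ i → Len x i → Len c (i + length r))
    chain-word x [] _ _ (zs , ends) =
      [] , refl , [] , trans (identityʳ x) x≡c ,
      λ i hx → subst₂ Len x≡c (sym (+-identityʳ i)) hx
      where
      x≡c : x ≡ c
      x≡c = snoc-singleton zs ends
    chain-word x (y ∷ rest) (_ ∷ y∈P ∷ inP) (x⋖y ∷ linked) (zs , ends)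
      with cover-is-letter y∈P x⋖y | chain-word y rest (y∈P ∷ inP) linked (snoc-tail zs ends)
    ... | a , Aa , x∙a≡y , length-step | r , chain , Ar , y∙r≡c , length-c =
      a ∷ r , cong (x ∷_) (trans (cong (λ t → prefixChain t r) x∙a≡y) chain) , Aa ∷ Ar ,
      trans (sym (assoc x a (pr r))) (trans (cong (_∙ pr r) x∙a≡y) y∙r≡c) ,
      λ i hx → subst (Len c) (sym (+-suc i (length r))) (length-c (suc i) (length-step i hx))

    maximal-chain-is-prefix-chain : ∀ {xs} → MaxChain Grp A c xs → ∃ λ r → Red c r × prefixChain e r ≡ xs
    maximal-chain-is-prefix-chain ((ys , refl) , ends , inP , linked) with chain-word e ys inP linked ends
    ... | r , chain , Ar , e∙r≡c , length-c =
      r , (Ar , trans (sym (identityˡ _)) e∙r≡c , proj₂ (length-c 0 length-e)) , chain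

  Step : List G → List G → Set
  Step = HurwitzStep Grp A

  HR : List G → List G → Set
  HR = HurwitzRelated Grp A

  hurwitz-sym : ∀ {u v} → HR u v → HR v u
  hurwitz-sym = reverse Sum.swap

  hurwitz-cons : ∀ x {u v} → HR u v → HR (x ∷ u) (x ∷ v)
  hurwitz-cons x = gmap (x ∷_) under-x
    where
    under-x : ∀ {u v} → Step u v ⊎ Step v u → Step (x ∷ u) (x ∷ v) ⊎ Step (x ∷ v) (x ∷ u)
    under-x (inj₁ s) = inj₁ (skip s)
    under-x (inj₂ s) = inj₂ (skip s)

  step-after : ∀ u {v w} → Step v w → Step (u ++ v) (u ++ w)
  step-after []      s = s
  step-after (_ ∷ u) s = skip (step-after u s)

  step-product : ∀ {u v} → Step u v → pr u ≡ pr v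
  step-product (swap {a} {b} {xs}) = sym (conj-slide b a (pr xs))
  step-product (skip {x} s)        = cong (x ∙_) (step-product s)

  step-length : ∀ {u v} → Step u v → length u ≡ length v
  step-length swap     = refl
  step-length (skip s) = cong suc (step-length s)

  -- Reducedness under conjugation (A closed under conjugation)

  module _ (conjClosed : ConjClosed Grp A) where

    step-letters : ∀ {u v} → Step u v → All A u → All A v
    step-letters (swap {a} {b}) (Aa ∷ Ab ∷ Axs) = Ab ∷ conjClosed b a Aa ∷ Axs
    step-letters (skip s)       (Ax ∷ Axs)      = Ax ∷ step-letters s Axs

    step-reduced : ∀ {c u v} → Step u v → Red c u → Red c v
    step-reduced s (Au , prod≡c , minimal) =
      step-letters s Au , trans (sym (step-product s)) prod≡c ,
      λ m f → subst (_≤ m) (step-length s) (minimal m f)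

    reduced-slide : ∀ {c} u w v → Red c (u ++ w ++ v) → Red c (w ++ map (conj (pr w)) u ++ v)
    reduced-slide u w v (A-uwv , prod≡c , minimal) =
      AllP.++⁺ (AllP.++⁻ˡ w A-wv) (AllP.++⁺ (AllP.map⁺ (All.map (conjClosed W _) (AllP.++⁻ˡ u A-uwv)))
                                            (AllP.++⁻ʳ w A-wv)) ,
      trans same-product prod≡c , λ m f → subst (_≤ m) (sym same-length) (minimal m f)
      where
      W : G
      W = pr w
      A-wv : All A (w ++ v)
      A-wv = AllP.++⁻ʳ u A-uwv
      same-product : pr (w ++ map (conj W) u ++ v) ≡ pr (u ++ w ++ v)
      same-product = begin
        pr (w ++ map (conj W) u ++ v)        ≡⟨ prod-++ w _ ⟩
        W ∙ pr (map (conj W) u ++ v)         ≡⟨ cong (W ∙_) (prod-++ (map (conj W) u) v) ⟩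
        W ∙ (pr (map (conj W) u) ∙ pr v)     ≡⟨ cong (λ t → W ∙ (t ∙ pr v)) (prod-conj W u) ⟩
        W ∙ (conj W (pr u) ∙ pr v)           ≡⟨ conj-slide W (pr u) (pr v) ⟩
        pr u ∙ (W ∙ pr v)                    ≡⟨ cong (pr u ∙_) (sym (prod-++ w v)) ⟩
        pr u ∙ pr (w ++ v)                   ≡⟨ sym (prod-++ u (w ++ v)) ⟩
        pr (u ++ w ++ v)                     ∎
      same-length : length (w ++ map (conj W) u ++ v) ≡ length (u ++ w ++ v)
      same-length = begin
        length (w ++ map (conj W) u ++ v)            ≡⟨ length-++ w ⟩
        length w + length (map (conj W) u ++ v)      ≡⟨ cong (length w +_) (length-++ (map (conj W) u)) ⟩
        length w + (length (map (conj W) u) + length v)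
          ≡⟨ cong (λ t → length w + (t + length v)) (length-map (conj W) u) ⟩
        length w + (length u + length v)             ≡⟨ x∙yz≈y∙xz (length w) (length u) (length v) ⟩
        length u + (length w + length v)            ≡⟨ cong (length u +_) (sym (length-++ w)) ⟩
        length u + length (w ++ v)                  ≡⟨ sym (length-++ u) ⟩
        length (u ++ w ++ v)                        ∎

    block-below : ∀ {c} u w v → Red c (u ++ w ++ v) → Len (pr w) (length w) × pr w ≤ₐ c
    block-below u w v rd with reduced-split w _ (reduced-slide u w v rd)
    ... | len-w , _ , w≤c = len-w , w≤c

    -- The local move, for a finite Red_A(c) with a c-compatible order

    module _ (c : G) (finite : RedFinite Grp A c) {_⪯_ : G → G → Set}
             (linear : IsLinearOrderOn Grp A c _⪯_) (compatible : IsCompatible Grp A c _⪯_) where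

      InAc : G → Set
      InAc = Ac Grp A c

      ⪯-refl : ∀ a → InAc a → a ⪯ a
      ⪯-refl = proj₁ linear

      ⪯-trans : ∀ a b d → InAc a → InAc b → InAc d → a ⪯ b → b ⪯ d → a ⪯ d
      ⪯-trans = proj₁ (proj₂ (proj₂ linear))

      ⪯-total : ∀ a b → InAc a → InAc b → a ⪯ b ⊎ b ⪯ a
      ⪯-total = proj₂ (proj₂ (proj₂ linear))

      module Orbit (u v : List G) (a b : G) (reduced : Red c (u ++ a ∷ b ∷ v)) where

        orbit : ℕ → G × G
        first second : ℕ → G
        first k  = proj₁ (orbit k)
        second k = proj₂ (orbit k)
        orbit zero    = a , b
        orbit (suc k) = second k , conj (second k) (first k)

        word : ℕ → List G
        word k = first k ∷ second k ∷ v

        orbit-reduced : ∀ k → Red c (u ++ word k)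
        orbit-reduced zero    = reduced
        orbit-reduced (suc k) = step-reduced (step-after u swap) (orbit-reduced k)

        orbit-path : ∀ k → HR (a ∷ b ∷ v) (word k)
        orbit-path zero    = ε
        orbit-path (suc k) = orbit-path k ◅◅ (inj₁ swap ◅ ε)

        orbit-product : ∀ k → first k ∙ second k ≡ a ∙ b
        orbit-product zero    = refl
        orbit-product (suc k) =
          trans (sym (assoc _ _ _)) (trans (cong (_∙ second k) (\\-leftDividesˡ (second k) (first k)))
                                           (orbit-product k))

        -- Every letter met along the orbit lies in A_c (second k is first (suc k)).
        orbit-in-Ac : ∀ k → InAc (first k)
        orbit-in-Ac k =
          letter-of-reduced u (first k) _ (orbit-reduced k) ,
          subst (_≤ₐ c) (identityʳ (first k)) (proj₂ (block-below u (first k ∷ []) _ (orbit-reduced k)))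

        pair-below : a ∙ b ≤ₐ c
        pair-below = subst (_≤ₐ c) (cong (a ∙_) (identityʳ b)) (proj₂ (block-below u (a ∷ b ∷ []) v reduced))

        pair-length : Len (a ∙ b) 2
        pair-length = subst (λ t → Len t 2) (cong (a ∙_) (identityʳ b)) (proj₁ (block-below u (a ∷ b ∷ []) v reduced))

        -- Red_A(c) is finite, so some first letter recurs.
        orbit-repeats : ∃ λ i → ∃ λ j → i < j × first i ≡ first j
        orbit-repeats with sequence-repeats (proj₁ finite) (λ k → u ++ word k)
                                            (λ k → proj₂ finite _ (orbit-reduced k))
        ... | i , j , i<j , same-word = i , j , i<j , proj₁ (∷-injective (++-cancelˡ u _ _ same-word))

        descent : ∀ i d → (∃ λ k → first k ⪯ second k) ⊎ first (d + suc i) ⪯ first (suc i)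
        descent i zero = inj₂ (⪯-refl _ (orbit-in-Ac (suc i)))
        descent i (suc d) with descent i d
        ... | inj₁ found = inj₁ found
        ... | inj₂ below with ⪯-total _ _ (orbit-in-Ac (d + suc i)) (orbit-in-Ac (suc (d + suc i)))
        ...   | inj₁ up   = inj₁ (d + suc i , up)
        ...   | inj₂ down =
          inj₂ (⪯-trans _ _ _ (orbit-in-Ac (suc (d + suc i))) (orbit-in-Ac (d + suc i)) (orbit-in-Ac (suc i))
                        down below)

        -- A decreasing run cannot return to its start, so some iterate is ⪯-increasing.
        ascent : ∃ λ k → first k ⪯ second k
        ascent with orbit-repeats
        ... | i , j , i<j , same with descent i (j ∸ suc i)
        ...   | inj₁ found = found
        ...   | inj₂ below =
          i , subst (_⪯ second i) (sym (trans same (cong first (sym (m∸n+n≡m i<j))))) below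

        reaches-canonical : ∀ {g} → a ∙ b ≡ g → ∀ α β →
                            (∀ a' b' → InAc a' → InAc b' → a' ∙ b' ≡ g → a' ⪯ b' → a' ≡ α × b' ≡ β) →
                            HR (a ∷ b ∷ v) (α ∷ β ∷ v)
        reaches-canonical ab≡g α β unique with ascent
        ... | k , increasing
          with unique (first k) (second k) (orbit-in-Ac k) (orbit-in-Ac (suc k))
                      (trans (orbit-product k) ab≡g) increasing
        ...   | refl , refl = orbit-path k

      -- Two reduced factorisations of c differing only in two adjacent letters with
      -- the same product are Hurwitz-related (through the canonical factorisation).
      local-move : ∀ u v a b a' b' → Red c (u ++ a ∷ b ∷ v) → Red c (u ++ a' ∷ b' ∷ v) →
                   a ∙ b ≡ a' ∙ b' → HR (a ∷ b ∷ v) (a' ∷ b' ∷ v)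
      local-move u v a b a' b' red red' same
        with compatible (a ∙ b) (Orbit.pair-below u v a b red) (Orbit.pair-length u v a b red)
      ... | α , β , _ , unique =
        Orbit.reaches-canonical u v a b red refl α β unique ◅◅
        hurwitz-sym (Orbit.reaches-canonical u v a' b' red' (sym same) α β unique)

      differ-at-head : ∀ u a b r s → Red c (u ++ a ∷ r) → Red c (u ++ b ∷ s) → pr u ∙ a ≢ pr u ∙ b →
                       prefixTail (pr u ∙ a) r ≡ prefixTail (pr u ∙ b) s → HR (a ∷ r) (b ∷ s)
      differ-at-head u a b [] [] red red' ua≢ub _ = ⊥-elim (ua≢ub (trans (ends red) (sym (ends red'))))
        where
        ends : ∀ {x} → Red c (u ++ x ∷ []) → pr u ∙ x ≡ c
        ends (_ , prod≡c , _) = trans (prod-snoc u _) prod≡c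
      differ-at-head u a b (a' ∷ r) (b' ∷ s) red red' _ tails with prefixChain-injective _ _ r s tails
      ... | uaa'≡ubb' , refl =
        local-move u r a a' b b' red red'
          (∙-cancelˡ (pr u) _ _ (trans (sym (assoc _ a a')) (trans uaa'≡ubb' (assoc _ b b'))))

      differ-by-one : ∀ u r s → Red c (u ++ r) → Red c (u ++ s) →
                      OneDiff Grp A (prefixTail (pr u) r) (prefixTail (pr u) s) → HR r s
      differ-by-one u (a ∷ r) (b ∷ s) red red' diff with oneDiff-cons diff
      ... | inj₁ (ua≢ub , tails) = differ-at-head u a b r s red red' ua≢ub tails
      ... | inj₂ (ua≡ub , diff') with ∙-cancelˡ (pr u) a b ua≡ub
      ...   | refl =
        hurwitz-cons a (differ-by-one (u ∷ʳ a) r s (reduced-snoc u a r red) (reduced-snoc u a s red')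
                                      (subst (λ t → OneDiff Grp A (prefixTail t r) (prefixTail t s))
                                             (prod-snoc u a) diff'))

      ChainStep : List G → List G → Set
      ChainStep xs ys = MaxChain Grp A c xs × MaxChain Grp A c ys × OneDiff Grp A xs ys

      along-chain-path : ∀ {xs ys} → Star ChainStep xs ys → ∀ r s → Red c r → Red c s →
                         prefixChain e r ≡ xs → prefixChain e s ≡ ys → HR r s
      along-chain-path ε r s _ _ r↦xs s↦xs with prefixChain-injective e e r s (trans r↦xs (sym s↦xs))
      ... | _ , refl = ε
      along-chain-path ((_ , max-t , diff) ◅ path) r s red-r red-s refl s↦ys
        with maximal-chain-is-prefix-chain c max-t
      ... | t , red-t , refl with oneDiff-cons diff
      ...   | inj₁ (e≢e , _)  = ⊥-elim (e≢e refl)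
      ...   | inj₂ (_ , diff') =
        differ-by-one [] r t red-r red-t diff' ◅◅ along-chain-path path t s red-t red-s refl s↦ys

theorem1p2 : {G : Set} (Grp : GroupOn G) (A : G → Set) (c : G) →
    MonoidGenerates Grp A → ConjClosed Grp A →
    RedFinite Grp A c → ChainConnected Grp A c → AdmitsCompatibleOrder Grp A c →
    ∀ r s → IsRed Grp A c r → IsRed Grp A c s → HurwitzRelated Grp A r s
theorem1p2 Grp A c _ conjClosed finite connected (_ , linear , compatible) r s red-r red-s =
  along-chain-path conjClosed c finite linear compatible
    (connected _ _ (prefix-chain-maximal c red-r) (prefix-chain-maximal c red-s))
    r s red-r red-s refl refl
  where open HurwitzTheory Grp A
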